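{- Let $a,b$ be positive integers, $P=[a]\times[b]$, $\mathbb{K}$ a field of characteristic zero, $C\in\mathbb{K}$ a generic constant, and $g\in\mathbb{K}^P$ a (generic) labeling. Then (1) $(\operatorname{BAR} g)(1,1)=\dfrac{C}{(\Delta^{ -1}g)(1,1)}$; (2) $(\operatorname{BAR} g)(1,j)=\dfrac{(\Delta^{ -1}g)(1,j-1)}{(\Delta^{ -1}g)(1,j)}$ for $j\ge2$; (3) $(\operatorname{BAR} g)(i,1)=\dfrac{(\Delta^{ -1}g)(i-1,1)}{(\Delta^{ -1}g)(i,1)}$ for $i\ge2$; (4) $(\operatorname{BAR} g)(i,j)=\dfrac{(\Delta^{ -1}g)(i-1,j)\cdot(\Delta^{ -1}g)(i,j-1)\cdot g(i-1,j-1)}{(\Delta^{ -1}g)(i-1,j-1)\cdot(\Delta^{ -1}g)(i,j)}$ for $i,j\ge2$.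
   Context: $[n]=\{1,\dots,n\}$; $P=[a]\times[b]$ has componentwise order, and $(i,j)$ is covered exactly by $(i+1,j)$ and $(i,j+1)$ when these lie in $P$. All maps are birational maps on $\mathbb{K}^P$ (labelings $P\to\mathbb{K}$), defined for generic labelings. Define: $(\Theta f)(x)=C/f(x)$; $(\nabla f)(x)=f(x)/\sum_{y\lessdot x}f(y)$, where the empty sum (for $x$ minimal) is replaced by $1$; $(\Delta^{ -1}f)(x)=\sum f(y_1)f(y_2)\cdots f(y_k)$ over all saturated chains $x=y_1\lessdot y_2\lessdot\cdots\lessdot y_k$ with $y_k$ maximal in $P$, equivalently $(\Delta^{ -1}f)(x)=f(x)\sum_{y\gtrdot x}(\Delta^{ -1}f)(y)$ with the empty sum equal to $1$. Birational antichain rowmotion is $\operatorname{BAR}=\nabla\circ\Theta\circ\Delta^{ -1}$. -}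

module Defs where

open import Level using (Level; _⊔_) renaming (suc to lsuc)
open import Data.Nat using (ℕ; zero; suc; _∸_; s≤s)
open import Data.Nat.Properties using (m∸n≤m)
open import Data.Fin using (Fin; zero; suc; toℕ; fromℕ<; inject₁)
open import Relation.Nullary using (¬_)
open import Algebra.Bundles using (CommutativeRing)

-- The inverse is given as
-- a total operation _⁻¹ (its value at 0 is irrelevant/unspecified).

record Field (c ℓ : Level) : Set (lsuc (c ⊔ ℓ)) where
  field
    commutativeRing : CommutativeRing c ℓ
  open CommutativeRing commutativeRing public
  field
    _⁻¹       : Carrier → Carrier
    ⁻¹-cong   : ∀ {x y} → x ≈ y → x ⁻¹ ≈ y ⁻¹
    inverseʳ  : ∀ x → ¬ (x ≈ 0#) → (x * (x ⁻¹)) ≈ 1#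
    0≉1       : ¬ (0# ≈ 1#)

  infixl 7 _/_
  _/_ : Carrier → Carrier → Carrier
  x / y = x * (y ⁻¹)

  natCast : ℕ → Carrier
  natCast zero    = 0#
  natCast (suc n) = 1# + natCast n

CharZero : ∀ {c ℓ} → Field c ℓ → Set ℓ
CharZero F = ∀ n → ¬ (natCast (suc n) ≈ 0#)
  where open Field F using (natCast; _≈_; 0#)

-- The poset P = [a] × [b] with a = suc m, b = suc n.  The element (i,j)
-- of the paper (1-based) is (i-1, j-1) : Fin (suc m) × Fin (suc n).

module _ {c ℓ} (F : Field c ℓ) where
  open Field F using (Carrier; _≈_; _+_; _*_; _/_; 0#; 1#)

  Labeling : ℕ → ℕ → Set c
  Labeling m n = Fin (suc m) → Fin (suc n) → Carrier

  Θ : ∀ {m n} → Carrier → Labeling m n → Labeling m n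
  Θ C f i j = C / f i j

  -- Σ_{y ⋖ x} f(y), with the empty sum (x minimal) replaced by 1.
  -- Lower covers of (i,j): (i-1,j) and (i,j-1) when in P.
  lowerSum : ∀ {m n} → Labeling m n → Labeling m n
  lowerSum f zero    zero    = 1#
  lowerSum f zero    (suc j) = f zero (inject₁ j)
  lowerSum f (suc i) zero    = f (inject₁ i) zero
  lowerSum f (suc i) (suc j) = f (inject₁ i) (suc j) + f (suc i) (inject₁ j)

  ∇ : ∀ {m n} → Labeling m n → Labeling m n
  ∇ f i j = f i j / lowerSum f i j

  -- Δ⁻¹ via the recursion
  --   (Δ⁻¹ f)(x) = f(x) · Σ_{y ⋗ x} (Δ⁻¹ f)(y)   (empty sum = 1).
  -- The auxiliary H p q computes the value at the point (m ∸ p, n ∸ q),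
  -- i.e. p, q are the distances to the top in each coordinate; upper
  -- covers of that point are at distances (p-1,q) and (p,q-1) when p>0,
  -- resp. q>0.
  pos : (k p : ℕ) → Fin (suc k)
  pos k p = fromℕ< (s≤s (m∸n≤m k p))

  module _ {m n : ℕ} (f : Labeling m n) where
    ΔH : ℕ → ℕ → Carrier
    ΔH zero    zero    = f (pos m zero) (pos n zero) * 1#
    ΔH (suc p) zero    = f (pos m (suc p)) (pos n zero) * ΔH p zero
    ΔH zero    (suc q) = f (pos m zero) (pos n (suc q)) * ΔH zero q
    ΔH (suc p) (suc q) = f (pos m (suc p)) (pos n (suc q))
                           * (ΔH p (suc q) + ΔH (suc p) q)

  Δ⁻¹ : ∀ {m n} → Labeling m n → Labeling m n
  Δ⁻¹ {m} {n} f i j = ΔH f (m ∸ toℕ i) (n ∸ toℕ j)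

  BAR : ∀ {m n} → Carrier → Labeling m n → Labeling m n
  BAR C f = ∇ (Θ C (Δ⁻¹ f))

  -- Genericity: all the denominators occurring in BAR C g are nonzero,
  -- i.e. g lies in the domain of definition of the birational map BAR:
  -- C ≠ 0, (Δ⁻¹ g)(x) ≠ 0 (denominator of Θ) and
  -- Σ_{y ⋖ x} (Θ Δ⁻¹ g)(y) ≠ 0 (denominator of ∇) for all x.
  record Generic {m n} (C : Carrier) (g : Labeling m n) : Set ℓ where
    field
      C≉0   : ¬ (C ≈ 0#)
      Δ⁻¹≉0 : ∀ i j → ¬ (Δ⁻¹ g i j ≈ 0#)
      ∇≉0   : ∀ i j → ¬ (lowerSum (Θ C (Δ⁻¹ g)) i j ≈ 0#)

-- Θ ∘ Δ⁻¹ sends g to C / h with h = Δ⁻¹ g, and ∇ divides each C / h(x) by the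
-- sum of C / h(y) over the lower covers y of x. On the bottom row and column
-- there is at most one lower cover, so the Cs cancel. In the interior, the
-- recursion h(i-1,j-1) = g(i-1,j-1) (h(i,j-1) + h(i-1,j)) turns the sum
-- C / h(i-1,j) + C / h(i,j-1) into C h(i-1,j-1) / (g(i-1,j-1) h(i-1,j) h(i,j-1)).
module Submission where

open import Defs
open import Data.Nat using (ℕ; suc; _∸_; s≤s⁻¹)
open import Data.Nat.Properties using (+-∸-assoc; m∸[m∸n]≡n)
open import Data.Fin using (Fin; zero; suc; inject₁; toℕ)
open import Data.Fin.Properties using (toℕ-injective; toℕ-fromℕ<; toℕ-inject₁; toℕ<n)
open import Data.Product using (_×_; _,_)
open import Relation.Nullary using (¬_)
open import Relation.Binary.PropositionalEquality as ≡ using (_≡_; module ≡-Reasoning)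

∸-toℕ-inject₁ : ∀ {k} (i : Fin k) → k ∸ toℕ (inject₁ i) ≡ suc (k ∸ toℕ (suc i))
∸-toℕ-inject₁ {k} i = begin
  k ∸ toℕ (inject₁ i)  ≡⟨ ≡.cong (k ∸_) (toℕ-inject₁ i) ⟩
  k ∸ toℕ i            ≡⟨ +-∸-assoc 1 (toℕ<n i) ⟩
  suc (k ∸ suc (toℕ i)) ∎
  where open ≡-Reasoning

module _ {c ℓ} (F : Field c ℓ) where
  open Field F using (_*_; _+_)

  pos-∸-toℕ : ∀ {k} (i : Fin (suc k)) → pos F k (k ∸ toℕ i) ≡ i
  pos-∸-toℕ {k} i = toℕ-injective (begin
    toℕ (pos F k (k ∸ toℕ i))  ≡⟨ toℕ-fromℕ< _ ⟩
    k ∸ (k ∸ toℕ i)            ≡⟨ m∸[m∸n]≡n (s≤s⁻¹ (toℕ<n i)) ⟩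
    toℕ i                      ∎)
    where open ≡-Reasoning

  pos-suc-∸-toℕ-suc : ∀ {k} (i : Fin k) → pos F k (suc (k ∸ toℕ (suc i))) ≡ inject₁ i
  pos-suc-∸-toℕ-suc {k} i = begin
    pos F k (suc (k ∸ toℕ (suc i)))  ≡⟨ ≡.cong (pos F k) (≡.sym (∸-toℕ-inject₁ i)) ⟩
    pos F k (k ∸ toℕ (inject₁ i))    ≡⟨ pos-∸-toℕ (inject₁ i) ⟩
    inject₁ i                        ∎
    where open ≡-Reasoning

  Δ⁻¹-unfold : ∀ {m n} (g : Labeling F m n) (i : Fin m) (j : Fin n) →
    Δ⁻¹ F g (inject₁ i) (inject₁ j) ≡
      g (inject₁ i) (inject₁ j) * (Δ⁻¹ F g (suc i) (inject₁ j) + Δ⁻¹ F g (inject₁ i) (suc j))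
  Δ⁻¹-unfold {m} {n} g i j = begin
    ΔH F g (m ∸ toℕ (inject₁ i)) (n ∸ toℕ (inject₁ j))
      ≡⟨ ≡.cong₂ (ΔH F g) (∸-toℕ-inject₁ i) (∸-toℕ-inject₁ j) ⟩
    g (pos F m (suc p)) (pos F n (suc q)) * (ΔH F g p (suc q) + ΔH F g (suc p) q)
      ≡⟨ ≡.cong₂ _*_ (≡.cong₂ g (pos-suc-∸-toℕ-suc i) (pos-suc-∸-toℕ-suc j))
                   (≡.cong₂ _+_ (≡.cong (ΔH F g p) (≡.sym (∸-toℕ-inject₁ j)))
                              (≡.cong (λ r → ΔH F g r q) (≡.sym (∸-toℕ-inject₁ i)))) ⟩
    g (inject₁ i) (inject₁ j) * (Δ⁻¹ F g (suc i) (inject₁ j) + Δ⁻¹ F g (inject₁ i) (suc j)) ∎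
    where
      open ≡-Reasoning
      p q : ℕ
      p = m ∸ toℕ (suc i)
      q = n ∸ toℕ (suc j)

module FieldDivision {c ℓ} (F : Field c ℓ) where
  open Field F
  open import Relation.Binary.Reasoning.Setoid setoid
  open import Algebra.Solver.Ring.NaturalCoefficients.Default commutativeSemiring
    using (solve; _:=_; _:+_; _:*_)

  1⁻¹≈1 : 1# ⁻¹ ≈ 1#
  1⁻¹≈1 = trans (sym (*-identityˡ _)) (inverseʳ 1# (λ 1≈0 → 0≉1 (sym 1≈0)))

  x/1≈x : ∀ x → x / 1# ≈ x
  x/1≈x x = trans (*-congˡ 1⁻¹≈1) (*-identityʳ x)

  x*y/y≈x : ∀ x {y} → ¬ (y ≈ 0#) → (x * y) / y ≈ x
  x*y/y≈x x {y} y≉0 = begin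
    (x * y) * y ⁻¹  ≈⟨ *-assoc x y (y ⁻¹) ⟩
    x * (y * y ⁻¹)  ≈⟨ *-congˡ (inverseʳ y y≉0) ⟩
    x * 1#          ≈⟨ *-identityʳ x ⟩
    x               ∎

  x/y*y≈x : ∀ x {y} → ¬ (y ≈ 0#) → (x / y) * y ≈ x
  x/y*y≈x x {y} y≉0 = begin
    (x * y ⁻¹) * y  ≈⟨ *-assoc x (y ⁻¹) y ⟩
    x * (y ⁻¹ * y)  ≈⟨ *-congˡ (*-comm (y ⁻¹) y) ⟩
    x * (y * y ⁻¹)  ≈⟨ *-assoc x y (y ⁻¹) ⟨
    (x * y) / y     ≈⟨ x*y/y≈x x y≉0 ⟩
    x               ∎

  x≉0∧y≉0⇒x*y≉0 : ∀ {x y} → ¬ (x ≈ 0#) → ¬ (y ≈ 0#) → ¬ (x * y ≈ 0#)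
  x≉0∧y≉0⇒x*y≉0 {x} {y} x≉0 y≉0 x*y≈0 = y≉0 (begin
    y            ≈⟨ x*y/y≈x y x≉0 ⟨
    (y * x) / x  ≈⟨ *-congʳ (*-comm y x) ⟩
    (x * y) / x  ≈⟨ *-congʳ x*y≈0 ⟩
    0# / x       ≈⟨ zeroˡ (x ⁻¹) ⟩
    0#           ∎)

  a*d≈c*b⇒a/b≈c/d : ∀ {a b c d} → ¬ (b ≈ 0#) → ¬ (d ≈ 0#) → a * d ≈ c * b → a / b ≈ c / d
  a*d≈c*b⇒a/b≈c/d {a} {b} {c} {d} b≉0 d≉0 a*d≈c*b = begin
    a / b              ≈⟨ x*y/y≈x (a / b) d≉0 ⟨
    ((a / b) * d) / d  ≈⟨ *-congʳ a/b*d≈c ⟩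
    c / d              ∎
    where
      a/b*d≈c : (a / b) * d ≈ c
      a/b*d≈c = begin
        (a * b ⁻¹) * d  ≈⟨ solve 3 (λ a d u → (a :* u) :* d := (a :* d) :* u) refl a d (b ⁻¹) ⟩
        (a * d) / b     ≈⟨ *-congʳ a*d≈c*b ⟩
        (c * b) / b     ≈⟨ x*y/y≈x c b≉0 ⟩
        c               ∎

  [z/y]/[z/x]≈x/y : ∀ {x y} z → ¬ (x ≈ 0#) → ¬ (y ≈ 0#) → ¬ (z / x ≈ 0#) →
                    (z / y) / (z / x) ≈ x / y
  [z/y]/[z/x]≈x/y {x} {y} z x≉0 y≉0 z/x≉0 = a*d≈c*b⇒a/b≈c/d z/x≉0 y≉0 (begin
    (z / y) * y  ≈⟨ x/y*y≈x z y≉0 ⟩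
    z            ≈⟨ x/y*y≈x z x≉0 ⟨
    (z / x) * x  ≈⟨ *-comm (z / x) x ⟩
    x * (z / x)  ∎)

  [z/d]/[z/b+z/c]≈bce/[ad] :
    ∀ {a b c d e} z → ¬ (a ≈ 0#) → ¬ (b ≈ 0#) → ¬ (c ≈ 0#) → ¬ (d ≈ 0#) →
    ¬ (z / b + z / c ≈ 0#) → a ≈ e * (c + b) →
    (z / d) / (z / b + z / c) ≈ ((b * c) * e) / (a * d)
  [z/d]/[z/b+z/c]≈bce/[ad] {a} {b} {c} {d} {e} z a≉0 b≉0 c≉0 d≉0 sum≉0 a≈e[c+b] =
    a*d≈c*b⇒a/b≈c/d sum≉0 (x≉0∧y≉0⇒x*y≉0 a≉0 d≉0) (begin
      (z / d) * (a * d)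
        ≈⟨ solve 3 (λ u a d → u :* (a :* d) := (u :* d) :* a) refl (z / d) a d ⟩
      ((z / d) * d) * a
        ≈⟨ *-cong (x/y*y≈x z d≉0) a≈e[c+b] ⟩
      z * (e * (c + b))
        ≈⟨ solve 4 (λ z e c b → z :* (e :* (c :+ b)) := z :* (c :* e) :+ z :* (b :* e))
                   refl z e c b ⟩
      z * (c * e) + z * (b * e)
        ≈⟨ +-cong (*-congʳ (x/y*y≈x z b≉0)) (*-congʳ (x/y*y≈x z c≉0)) ⟨
      ((z / b) * b) * (c * e) + ((z / c) * c) * (b * e)
        ≈⟨ solve 5 (λ b c e u v → (u :* b) :* (c :* e) :+ (v :* c) :* (b :* e)
                                 := ((b :* c) :* e) :* (u :+ v))
                   refl b c e (z / b) (z / c) ⟩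
      ((b * c) * e) * (z / b + z / c)  ∎)

open Field using (_≈_; _*_; _/_)

theorem5p1 : ∀ {c ℓ} (F : Field c ℓ) → CharZero F →
    (m n : ℕ) (C : Field.Carrier F) (g : Labeling F m n) → Generic F C g →
    let h = Δ⁻¹ F g
        β = BAR F C g
    in (_≈_ F (β zero zero) (_/_ F C (h zero zero)))
       × (∀ (j : Fin n) →
            _≈_ F (β zero (suc j)) (_/_ F (h zero (inject₁ j)) (h zero (suc j))))
       × (∀ (i : Fin m) →
            _≈_ F (β (suc i) zero) (_/_ F (h (inject₁ i) zero) (h (suc i) zero)))
       × (∀ (i : Fin m) (j : Fin n) →
            _≈_ F (β (suc i) (suc j))
              (_/_ F (_*_ F (_*_ F (h (inject₁ i) (suc j)) (h (suc i) (inject₁ j)))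
                           (g (inject₁ i) (inject₁ j)))
                     (_*_ F (h (inject₁ i) (inject₁ j)) (h (suc i) (suc j)))))
theorem5p1 F _ _ _ C g generic =
    x/1≈x (_/_ F C (Δ⁻¹ F g zero zero))
  , (λ j → [z/y]/[z/x]≈x/y C (Δ⁻¹≉0 zero (inject₁ j)) (Δ⁻¹≉0 zero (suc j)) (∇≉0 zero (suc j)))
  , (λ i → [z/y]/[z/x]≈x/y C (Δ⁻¹≉0 (inject₁ i) zero) (Δ⁻¹≉0 (suc i) zero) (∇≉0 (suc i) zero))
  , λ i j → [z/d]/[z/b+z/c]≈bce/[ad] C
      (Δ⁻¹≉0 (inject₁ i) (inject₁ j)) (Δ⁻¹≉0 (inject₁ i) (suc j))
      (Δ⁻¹≉0 (suc i) (inject₁ j)) (Δ⁻¹≉0 (suc i) (suc j))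
      (∇≉0 (suc i) (suc j)) (Field.reflexive F (Δ⁻¹-unfold F g i j))
  where
    open FieldDivision F
    open Generic generic
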